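{- Let $A,B$ be two intervals of a chain $C$, one of them an $\equiv_{well}$-equivalence class and the other an $\equiv_{well^*}$-equivalence class. If $A\cap B$, $A\setminus B$ and $B\setminus A$ are all non-empty, then $A\cap B$ is either finite or has order type $\omega^*+\omega$.
   Context: A chain is a linearly ordered set. For $x,y\in C$, $x\equiv_{well}y$ (resp. $x\equiv_{well^*}y$) iff the closed interval between $x$ and $y$ is well ordered (resp. reversely well ordered). $\omega^*$ is the reverse of $\omega$, so $\omega^*+\omega$ is the order type of $\mathbb{Z}$. -}

module Defs where

open import Level using (0ℓ)
open import Data.Nat using (ℕ)
open import Data.Fin using (Fin)
open import Data.Integer as ℤ using (ℤ)
open import Data.Product using (Σ; ∃; _×_; _,_)
open import Data.Sum using (_⊎_)
open import Relation.Nullary using (¬_)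
open import Relation.Binary.PropositionalEquality using (_≡_)

Subset : Set → Set₁
Subset C = C → Set

module _ {C : Set} (_<_ : C → C → Set) where

  _≤_ : C → C → Set
  x ≤ y = (x < y) ⊎ (x ≡ y)

  IsInterval : Subset C → Set
  IsInterval S = ∀ x y z → S x → S z → x < y → y < z → S y

  ClosedBetween : C → C → Subset C
  ClosedBetween x y z = ((x ≤ z) × (z ≤ y)) ⊎ ((y ≤ z) × (z ≤ x))

  WellOrdered : Subset C → Set₁
  WellOrdered S = (T : Subset C) → (∀ z → T z → S z) → (∃ λ z → T z) →
                  ∃ λ m → T m × (∀ z → T z → m ≤ z)

  ReverseWellOrdered : Subset C → Set₁
  ReverseWellOrdered S = (T : Subset C) → (∀ z → T z → S z) → (∃ λ z → T z) →
                         ∃ λ m → T m × (∀ z → T z → z ≤ m)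

  _≡well_ : C → C → Set₁
  x ≡well y = WellOrdered (ClosedBetween x y)

  _≡well*_ : C → C → Set₁
  x ≡well* y = ReverseWellOrdered (ClosedBetween x y)

  IsWellClass : Subset C → Set₁
  IsWellClass A = ∃ λ a → A a × (∀ x → (A x → a ≡well x) × (a ≡well x → A x))

  IsWell*Class : Subset C → Set₁
  IsWell*Class A = ∃ λ a → A a × (∀ x → (A x → a ≡well* x) × (a ≡well* x → A x))

  IsFinite : Subset C → Set
  IsFinite S = ∃ λ (n : ℕ) → ∃ λ (f : Fin n → C) →
               (∀ i → S (f i)) × (∀ z → S z → ∃ λ i → f i ≡ z)

  -- S has order type ω* + ω (the order type of ℤ):
  -- there is an order isomorphism from (ℤ, <) onto (S, <)
  HasOrderTypeℤ : Subset C → Set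
  HasOrderTypeℤ S = ∃ λ (f : ℤ → C) →
                    (∀ i → S (f i)) ×
                    (∀ i j → i ℤ.< j → f i < f j) ×
                    (∀ z → S z → ∃ λ i → f i ≡ z)

  _∩_ : Subset C → Subset C → Subset C
  (A ∩ B) x = A x × B x

  _∖_ : Subset C → Subset C → Subset C
  (A ∖ B) x = A x × ¬ B x

  NonEmpty : Subset C → Set
  NonEmpty S = ∃ λ x → S x

-- Let A be a ≡well-class and B a ≡well*-class (the other case is symmetric), u ∈ A ∖ B,
-- v ∈ B ∖ A and S = A ∩ B. Every closed interval with endpoints in S is both well ordered and
-- reversely well ordered, and S lies strictly between u and v.
-- If u < v, S has a least element (found in [u, s] for any s ∈ S) and a greatest one (found in
-- [s, v]); iterating the successor function of S from its least element exhausts S, so S is finite.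
-- If v < u, S has no least element: for x ∈ S the greatest point p of [v, x) lies in B, and if p ∉ A
-- then p is adjacent to x, hence ≡well-equivalent to x, hence in A. Dually S has no greatest element;
-- iterating the successor and predecessor functions of S from one of its points enumerates S as ℤ.

module Submission where

open import Defs hiding (_≤_)
open import Level using (0ℓ; lift; lower)
open import Function.Base using (flip; _∘_; _∘₂_; id)
open import Data.Empty using (⊥; ⊥-elim)
open import Data.Sum as Sum using (_⊎_; inj₁; inj₂; [_,_])
open import Data.Product as Product using (_×_; _,_; proj₁; proj₂; ∃)
open import Data.Nat as ℕ using (ℕ; zero; suc)
import Data.Nat.Properties as ℕ
open import Data.Fin using (toℕ; fromℕ; fromℕ<)
open import Data.Fin.Properties using (toℕ-fromℕ; toℕ-fromℕ<)
open import Data.Integer as ℤ using (ℤ; +_; -[1+_])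
open import Relation.Nullary using (¬_; Dec; yes; no)
open import Relation.Nullary.Decidable using (map′; decidable-stable)
open import Relation.Unary using (_⊆′_; _≐′_; Satisfiable; ｛_｝; _∪_)
open import Relation.Binary.Core using (_⇒_)
open import Relation.Binary.Definitions using (Symmetric; Transitive; tri<; tri≈; tri>)
open import Relation.Binary.Structures using (IsStrictTotalOrder; IsTotalPreorder; IsDecTotalOrder)
open import Relation.Binary.PropositionalEquality using (_≡_; refl; sym; trans; subst; cong)
import Relation.Binary.Construct.Flip.EqAndOrd as Flip
import Relation.Binary.Construct.StrictToNonStrict as NonStrict
open import Axiom.ExcludedMiddle using (ExcludedMiddle)

decide : ExcludedMiddle (Level.suc 0ℓ) → (P : Set) → Dec P
decide em P = map′ lower lift em

module _ {C : Set} where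

  Least : (C → C → Set) → Subset C → C → Set
  Least R T m = T m × (∀ z → T z → R m z)

  WellOrderedBy : (C → C → Set) → Subset C → Set₁
  WellOrderedBy R S = (T : Subset C) → T ⊆′ S → Satisfiable T → ∃ (Least R T)

  wellOrderedBy-map : ∀ {R R′ S S′} → R ⇒ R′ → S′ ⊆′ S → WellOrderedBy R S → WellOrderedBy R′ S′
  wellOrderedBy-map R⇒R′ S′⊆S wo T T⊆S′ ne with wo T (λ z → S′⊆S z ∘ T⊆S′ z) ne
  ... | m , tm , least = m , tm , λ z tz → R⇒R′ (least z tz)

  IsClass : (C → C → Set₁) → Subset C → Set₁
  IsClass _≈_ A = ∃ λ a → A a × (∀ x → (A x → a ≈ x) × (a ≈ x → A x))

  isClass-map : ∀ {_≈_ _≈′_ A} → _≈_ ⇒ _≈′_ → _≈′_ ⇒ _≈_ → IsClass _≈_ A → IsClass _≈′_ A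
  isClass-map ≈⇒≈′ ≈′⇒≈ (a , Aa , class) =
    a , Aa , λ x → ≈⇒≈′ ∘ proj₁ (class x) , proj₂ (class x) ∘ ≈′⇒≈

  module _ {_≈_ : C → C → Set₁} (≈-sym : Symmetric _≈_) (≈-trans : Transitive _≈_)
           {A : Subset C} (A-class : IsClass _≈_ A) where

    private
      representative-≈ : ∀ {x} → A x → proj₁ A-class ≈ x
      representative-≈ = proj₁ (proj₂ (proj₂ A-class) _)

      ≈-representative⇒∈ : ∀ {x} → proj₁ A-class ≈ x → A x
      ≈-representative⇒∈ = proj₂ (proj₂ (proj₂ A-class) _)

    class-related : ∀ {x y} → A x → A y → x ≈ y
    class-related Ax Ay = ≈-trans (≈-sym (representative-≈ Ax)) (representative-≈ Ay)

    class-closed : ∀ {x y} → A x → x ≈ y → A y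
    class-closed Ax x≈y = ≈-representative⇒∈ (≈-trans (representative-≈ Ax) x≈y)

module WellOrderedByTotalPreorder {C : Set} {R : C → C → Set} (R-totalPreorder : IsTotalPreorder _≡_ R)
                                  (decide : (P : Set) → Dec P) where
  open IsTotalPreorder R-totalPreorder using (reflexive; total) renaming (trans to R-trans)

  wellOrderedBy-singleton : ∀ p → WellOrderedBy R ｛ p ｝
  wellOrderedBy-singleton p T T⊆p (z , Tz) with T⊆p z Tz
  ... | refl = z , Tz , λ w Tw → reflexive (T⊆p w Tw)

  least-of-cover : ∀ {T S₁ S₂ m₁ m₂} → T ⊆′ S₁ ∪ S₂ →
                   Least R (λ z → T z × S₁ z) m₁ → Least R (λ z → T z × S₂ z) m₂ → ∃ (Least R T)
  least-of-cover {m₁ = m₁} {m₂} T⊆ ((Tm₁ , _) , least₁) ((Tm₂ , _) , least₂) with total m₁ m₂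
  ... | inj₁ m₁≤m₂ = m₁ , Tm₁ , λ z Tz →
    [ (λ S₁z → least₁ z (Tz , S₁z)) , (λ S₂z → R-trans m₁≤m₂ (least₂ z (Tz , S₂z))) ] (T⊆ z Tz)
  ... | inj₂ m₂≤m₁ = m₂ , Tm₂ , λ z Tz →
    [ (λ S₁z → R-trans m₂≤m₁ (least₁ z (Tz , S₁z))) , (λ S₂z → least₂ z (Tz , S₂z)) ] (T⊆ z Tz)

  wellOrderedBy-∪ : ∀ {S₁ S₂} → WellOrderedBy R S₁ → WellOrderedBy R S₂ → WellOrderedBy R (S₁ ∪ S₂)
  wellOrderedBy-∪ {S₁} {S₂} wo₁ wo₂ T T⊆ ne
    with decide (Satisfiable (λ z → T z × S₁ z)) | decide (Satisfiable (λ z → T z × S₂ z))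
  ... | yes ne₁ | yes ne₂ with wo₁ _ (λ _ → proj₂) ne₁ | wo₂ _ (λ _ → proj₂) ne₂
  ...   | _ , least₁ | _ , least₂ = least-of-cover T⊆ least₁ least₂
  wellOrderedBy-∪ wo₁ _ T T⊆ ne | _ | no ¬ne₂ =
    wo₁ T (λ z Tz → [ id , (λ S₂z → ⊥-elim (¬ne₂ (z , Tz , S₂z))) ] (T⊆ z Tz)) ne
  wellOrderedBy-∪ _ wo₂ T T⊆ ne | no ¬ne₁ | _ =
    wo₂ T (λ z Tz → [ (λ S₁z → ⊥-elim (¬ne₁ (z , Tz , S₁z))) , id ] (T⊆ z Tz)) ne

module Chain {C : Set} {_<_ : C → C → Set} (sto : IsStrictTotalOrder _≡_ _<_)
             (decide : (P : Set) → Dec P) where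

  open IsStrictTotalOrder sto using (compare; irrefl; <-respʳ-≈) renaming (trans to <-trans)
  open NonStrict _≡_ _<_ using (_≤_)
  open IsDecTotalOrder (NonStrict.isDecTotalOrder _≡_ _<_ sto) using (antisym; total; isTotalPreorder)
    renaming (refl to ≤-refl; trans to ≤-trans)

  <-≤-trans : ∀ {x y z} → x < y → y ≤ z → x < z
  <-≤-trans = NonStrict.<-≤-trans _≡_ _<_ <-trans <-respʳ-≈

  <⇒≱ : ∀ {x y} → x < y → ¬ (y ≤ x)
  <⇒≱ x<y y≤x = irrefl refl (<-≤-trans x<y y≤x)

  between-sym : ∀ {x y} → ClosedBetween _<_ x y ⊆′ ClosedBetween _<_ y x
  between-sym _ = Sum.swap

  between-split : ∀ {x y} a → ClosedBetween _<_ x y ⊆′ ClosedBetween _<_ x a ∪ ClosedBetween _<_ a y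
  between-split a z (inj₁ (x≤z , z≤y)) with total a z
  ... | inj₁ a≤z = inj₂ (inj₁ (a≤z , z≤y))
  ... | inj₂ z≤a = inj₁ (inj₁ (x≤z , z≤a))
  between-split a z (inj₂ (y≤z , z≤x)) with total a z
  ... | inj₁ a≤z = inj₁ (inj₂ (a≤z , z≤x))
  ... | inj₂ z≤a = inj₂ (inj₂ (y≤z , z≤a))

  between-adjacent : ∀ {x y} → x < y → (∀ z → x < z → z < y → ⊥) →
                     ClosedBetween _<_ x y ⊆′ ｛ x ｝ ∪ ｛ y ｝
  between-adjacent _ _ z (inj₁ (inj₂ x≡z , _)) = inj₁ x≡z
  between-adjacent _ _ z (inj₁ (inj₁ _ , inj₂ z≡y)) = inj₂ (sym z≡y)
  between-adjacent _ gap z (inj₁ (inj₁ x<z , inj₁ z<y)) = ⊥-elim (gap z x<z z<y)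
  between-adjacent x<y _ z (inj₂ (y≤z , z≤x)) = ⊥-elim (<⇒≱ x<y (≤-trans y≤z z≤x))

  module Classes {R : C → C → Set} (R-totalPreorder : IsTotalPreorder _≡_ R) where
    open WellOrderedByTotalPreorder R-totalPreorder decide

    _≈_ : C → C → Set₁
    x ≈ y = WellOrderedBy R (ClosedBetween _<_ x y)

    ≈-sym : Symmetric _≈_
    ≈-sym = wellOrderedBy-map id between-sym

    ≈-trans : Transitive _≈_
    ≈-trans {j = a} x≈a a≈y = wellOrderedBy-map id (between-split a) (wellOrderedBy-∪ x≈a a≈y)

    adjacent⇒≈ : ∀ {x y} → x < y → (∀ z → x < z → z < y → ⊥) → x ≈ y
    adjacent⇒≈ {x} {y} x<y gap =
      wellOrderedBy-map id (between-adjacent x<y gap)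
        (wellOrderedBy-∪ (wellOrderedBy-singleton x) (wellOrderedBy-singleton y))

    related : ∀ {A x y} → IsClass _≈_ A → A x → A y → x ≈ y
    related A-class = class-related ≈-sym ≈-trans A-class

    closed : ∀ {A x y} → IsClass _≈_ A → A x → x ≈ y → A y
    closed A-class = class-closed ≈-sym ≈-trans A-class

  module W  = Classes isTotalPreorder
  module W* = Classes (Flip.isTotalPreorder isTotalPreorder)

  interval-∋ : ∀ {S x y z} → IsInterval _<_ S → S x → S z → x ≤ y → y ≤ z → S y
  interval-∋ _ Sx _ (inj₂ refl) _ = Sx
  interval-∋ _ _ Sz (inj₁ _) (inj₂ refl) = Sz
  interval-∋ S-int Sx Sz (inj₁ x<y) (inj₁ y<z) = S-int _ _ _ Sx Sz x<y y<z

  ∩-interval : ∀ {A B} → IsInterval _<_ A → IsInterval _<_ B → IsInterval _<_ (_∩_ _<_ A B)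
  ∩-interval A-int B-int x y z (Ax , Bx) (Az , Bz) x<y y<z =
    A-int x y z Ax Az x<y y<z , B-int x y z Bx Bz x<y y<z

  ∩-between : ∀ {A B u v s} → IsInterval _<_ A → IsInterval _<_ B →
              A u → ¬ B u → B v → ¬ A v → u < v → A s → B s → u < s × s < v
  ∩-between {u = u} {v} {s} A-int B-int Au ¬Bu Bv ¬Av u<v As Bs = u<s , s<v
    where
    u<s : u < s
    u<s with compare u s
    ... | tri< u<s _ _ = u<s
    ... | tri≈ _ refl _ = ⊥-elim (¬Bu Bs)
    ... | tri> _ _ s<u = ⊥-elim (¬Bu (B-int s u v Bs Bv s<u u<v))
    s<v : s < v
    s<v with compare s v
    ... | tri< s<v _ _ = s<v
    ... | tri≈ _ refl _ = ⊥-elim (¬Av As)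
    ... | tri> _ _ v<s = ⊥-elim (¬Av (A-int u v s Au As u<v v<s))

  least-of-lower : ∀ {S s m} → Least _≤_ (λ z → S z × z ≤ s) m → Least _≤_ S m
  least-of-lower {s = s} ((Sm , m≤s) , least) = Sm , λ z Sz →
    [ (λ z≤s → least z (Sz , z≤s)) , (λ s≤z → ≤-trans m≤s s≤z) ] (total z s)

  greatest-of-upper : ∀ {S s m} → Least (flip _≤_) (λ z → S z × s ≤ z) m → Least (flip _≤_) S m
  greatest-of-upper {s = s} ((Sm , s≤m) , greatest) = Sm , λ z Sz →
    [ (λ s≤z → greatest z (Sz , s≤z)) , (λ z≤s → ≤-trans z≤s s≤m) ] (total s z)

  no-least-in-∩ : ∀ {A B x y} → IsWellClass _<_ A → IsWell*Class _<_ B → IsInterval _<_ B →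
                  B y → ¬ A y → y < x → A x → B x → ∃ λ z → _∩_ _<_ A B z × z < x
  no-least-in-∩ {A} {x = x} {y} A-class B-class B-int By ¬Ay y<x Ax Bx
    with W*.related B-class By Bx (λ w → y ≤ w × w < x) (λ w (y≤w , w<x) → inj₁ (y≤w , inj₁ w<x))
                    (y , ≤-refl , y<x)
  ... | p , (y≤p , p<x) , greatest with decide (A p)
  ...   | yes Ap = p , (Ap , interval-∋ B-int By Bx y≤p (inj₁ p<x)) , p<x
  ...   | no ¬Ap = ⊥-elim (¬Ap (W.closed A-class Ax (W.≈-sym (W.adjacent⇒≈ p<x gap))))
    where
    gap : ∀ z → p < z → z < x → ⊥
    gap z p<z z<x = <⇒≱ p<z (greatest z (≤-trans y≤p (inj₁ p<z) , z<x))

  record AscendingEnumeration (S : Subset C) (x : C) : Set where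
    field
      seq            : ℕ → C
      seq-zero       : seq 0 ≡ x
      seq-∈          : ∀ n → S (seq n)
      seq-strictMono : ∀ {m n} → m ℕ.< n → seq m < seq n
      seq-onto       : ∀ {z} → S z → x ≤ z → ∃ λ n → seq n ≡ z

    start-≤ : ∀ n → x ≤ seq n
    start-≤ zero = inj₂ (sym seq-zero)
    start-≤ (suc n) = inj₁ (subst (_< seq (suc n)) seq-zero (seq-strictMono (ℕ.s≤s ℕ.z≤n)))

  module Successor (S : Subset C) (S-int : IsInterval _<_ S)
                   (S-wo : ∀ {x y} → S x → S y → x W.≈ y) (S-wo* : ∀ {x y} → S x → S y → x W*.≈ y) where

    Above : C → Subset C
    Above x z = S z × x < z

    -- The successor of the greatest element of S is taken to be that element itself.
    Next : C → C → Set
    Next x y = Least _≤_ (Above x) y ⊎ (¬ Satisfiable (Above x) × x ≡ y)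

    next : ((x , _) : ∃ S) → ∃ λ y → S y × Next x y
    next (x , Sx) with decide (Satisfiable (Above x))
    ... | no none = x , Sx , inj₂ (none , refl)
    ... | yes (z , Sz , x<z)
      with S-wo Sx Sz (λ w → Above x w × w ≤ z) (λ w ((_ , x<w) , w≤z) → inj₁ (inj₁ x<w , w≤z))
                (z , (Sz , x<z) , ≤-refl)
    ...   | y , least = y , proj₁ (proj₁ (proj₁ least)) , inj₁ (least-of-lower least)

    Next-≤ : ∀ {x y} → Next x y → x ≤ y
    Next-≤ (inj₁ ((_ , x<y) , _)) = inj₁ x<y
    Next-≤ (inj₂ (_ , x≡y)) = inj₂ x≡y

    Next-< : ∀ {x y} → Satisfiable (Above x) → Next x y → x < y
    Next-< _ (inj₁ ((_ , x<y) , _)) = x<y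
    Next-< above (inj₂ (none , _)) = ⊥-elim (none above)

    Next-unique : ∀ {x y y′} → Next x y → Next x y′ → y ≡ y′
    Next-unique (inj₁ (Ay , least)) (inj₁ (Ay′ , least′)) = antisym (least _ Ay′) (least′ _ Ay)
    Next-unique (inj₂ (_ , refl)) (inj₂ (_ , refl)) = refl
    Next-unique (inj₁ (Ay , _)) (inj₂ (none , _)) = ⊥-elim (none (_ , Ay))
    Next-unique (inj₂ (none , _)) (inj₁ (Ay′ , _)) = ⊥-elim (none (_ , Ay′))

    predecessor : ∀ {x t} → S x → S t → x < t → ∃ λ p → (x ≤ p × p < t) × Next p t
    predecessor {x} {t} Sx St x<t
      with S-wo* Sx St (λ w → x ≤ w × w < t) (λ w (x≤w , w<t) → inj₁ (x≤w , inj₁ w<t)) (x , ≤-refl , x<t)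
    ... | p , (x≤p , p<t) , greatest = p , (x≤p , p<t) , inj₁ ((St , p<t) , t-least)
      where
      t-least : ∀ z → Above p z → t ≤ z
      t-least z (_ , p<z) with compare z t
      ... | tri< z<t _ _ = ⊥-elim (<⇒≱ p<z (greatest z (≤-trans x≤p (inj₁ p<z) , z<t)))
      ... | tri≈ _ z≡t _ = inj₂ (sym z≡t)
      ... | tri> _ _ t<z = inj₁ t<z

    module From {x₀ : C} (Sx₀ : S x₀) where

      point : ℕ → ∃ S
      point zero = x₀ , Sx₀
      point (suc n) = let y , Sy , _ = next (point n) in y , Sy

      seq : ℕ → C
      seq = proj₁ ∘ point

      seq-∈ : ∀ n → S (seq n)
      seq-∈ = proj₂ ∘ point

      seq-next : ∀ n → Next (seq n) (seq (suc n))
      seq-next n = proj₂ (proj₂ (next (point n)))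

      seq-mono : ∀ {m n} → m ℕ.≤′ n → seq m ≤ seq n
      seq-mono ℕ.≤′-refl = ≤-refl
      seq-mono (ℕ.≤′-step {n} m≤′n) = ≤-trans (seq-mono m≤′n) (Next-≤ (seq-next n))

      Reached : Subset C
      Reached z = ∃ λ n → seq n ≡ z

      Unreached : C → Subset C
      Unreached z w = (x₀ ≤ w × w ≤ z) × ¬ Reached w

      -- The least unreached point would be the successor of its predecessor, which is reached.
      no-least-unreached : ∀ {z} → S z → ¬ ∃ (Least _≤_ (Unreached z))
      no-least-unreached Sz (t , ((x₀≤t , t≤z) , ¬Rt) , least) with x₀≤t
      ... | inj₂ x₀≡t = ¬Rt (0 , x₀≡t)
      ... | inj₁ x₀<t with predecessor Sx₀ (interval-∋ S-int Sx₀ Sz x₀≤t t≤z) x₀<t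
      ...   | p , (x₀≤p , p<t) , Next-p-t with decidable-stable (decide (Reached p))
                (λ ¬Rp → <⇒≱ p<t (least p ((x₀≤p , ≤-trans (inj₁ p<t) t≤z) , ¬Rp)))
      ...     | n , refl = ¬Rt (suc n , Next-unique (seq-next n) Next-p-t)

      reach : ∀ {z} → S z → x₀ ≤ z → Reached z
      reach {z} Sz x₀≤z = decidable-stable (decide (Reached z)) λ ¬Rz →
        no-least-unreached Sz (S-wo Sx₀ Sz (Unreached z) (λ w (x₀≤w≤z , _) → inj₁ x₀≤w≤z)
                                          (z , (x₀≤z , ≤-refl) , ¬Rz))

    finite : ∀ {m M} → Least _≤_ S m → Least (flip _≤_) S M → IsFinite _<_ S
    finite {M = M} (Sm , m-least) (SM , M-greatest) = enumerate (reach SM (m-least M SM))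
      where
      open From Sm
      enumerate : Reached M → IsFinite _<_ S
      enumerate (N , seqN≡M) = suc N , seq ∘ toℕ , seq-∈ ∘ toℕ , onto
        where
        onto : ∀ z → S z → ∃ λ i → seq (toℕ i) ≡ z
        onto z Sz with reach Sz (m-least z Sz)
        ... | k , refl with ℕ.≤-total k N
        ... | inj₁ k≤N = fromℕ< (ℕ.s≤s k≤N) , cong seq (toℕ-fromℕ< (ℕ.s≤s k≤N))
        ... | inj₂ N≤k = fromℕ N , trans (cong seq (toℕ-fromℕ N))
                           (antisym (seq-mono (ℕ.≤⇒≤′ N≤k)) (subst (seq k ≤_) (sym seqN≡M) (M-greatest _ Sz)))

    ascending : (∀ x → S x → ∃ λ z → Above x z) → ∀ {x} → S x → AscendingEnumeration S x
    ascending no-greatest Sx = record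
      { seq            = seq
      ; seq-zero       = refl
      ; seq-∈          = seq-∈
      ; seq-strictMono = strictMono ∘ ℕ.<⇒<′
      ; seq-onto       = reach
      }
      where
      open From Sx
      seq-<-suc : ∀ n → seq n < seq (suc n)
      seq-<-suc n = Next-< (no-greatest _ (seq-∈ n)) (seq-next n)
      strictMono : ∀ {m n} → m ℕ.<′ n → seq m < seq n
      strictMono {m} ℕ.<′-base = seq-<-suc m
      strictMono (ℕ.<′-step {n} m<′n) = <-trans (strictMono m<′n) (seq-<-suc n)

  ∩-wellOrdered : ∀ {A B x y} → IsWellClass _<_ A → _∩_ _<_ A B x → _∩_ _<_ A B y → x W.≈ y
  ∩-wellOrdered A-class (Ax , _) (Ay , _) = W.related A-class Ax Ay

  ∩-reverseWellOrdered : ∀ {A B x y} → IsWell*Class _<_ B → _∩_ _<_ A B x → _∩_ _<_ A B y → x W*.≈ y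
  ∩-reverseWellOrdered B-class (_ , Bx) (_ , By) = W*.related B-class Bx By

  ∩-isFinite : ∀ {A B u v s} → IsInterval _<_ A → IsInterval _<_ B →
               IsWellClass _<_ A → IsWell*Class _<_ B →
             A u → ¬ B u → B v → ¬ A v → u < v → _∩_ _<_ A B s → IsFinite _<_ (_∩_ _<_ A B)
  ∩-isFinite {A} {B} {u} {v} {s} A-int B-int A-class B-class Au ¬Bu Bv ¬Av u<v (As , Bs) =
    finite (least-of-lower (proj₂ least)) (greatest-of-upper (proj₂ greatest))
    where
    S : Subset C
    S = _∩_ _<_ A B
    open Successor S (∩-interval A-int B-int)
                   (∩-wellOrdered {B = B} A-class) (∩-reverseWellOrdered {A = A} B-class)
    between : ∀ {z} → S z → u < z × z < v
    between (Az , Bz) = ∩-between A-int B-int Au ¬Bu Bv ¬Av u<v Az Bz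
    least : ∃ (Least _≤_ (λ z → S z × z ≤ s))
    least = W.related A-class Au As (λ z → S z × z ≤ s)
              (λ z (Sz , z≤s) → inj₁ (inj₁ (proj₁ (between Sz)) , z≤s)) (s , (As , Bs) , ≤-refl)
    greatest : ∃ (Least (flip _≤_) (λ z → S z × s ≤ z))
    greatest = W*.related B-class Bs Bv (λ z → S z × s ≤ z)
                 (λ z (Sz , s≤z) → inj₁ (s≤z , inj₁ (proj₂ (between Sz)))) (s , (As , Bs) , ≤-refl)

  _≤ᵒᵖ_ : C → C → Set
  _≤ᵒᵖ_ = NonStrict._≤_ _≡_ (flip _<_)

  ≤⇒≥ᵒᵖ : ∀ {x y} → x ≤ y → y ≤ᵒᵖ x
  ≤⇒≥ᵒᵖ = Sum.map₂ sym

  ≤ᵒᵖ⇒≥ : ∀ {x y} → x ≤ᵒᵖ y → y ≤ x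
  ≤ᵒᵖ⇒≥ = Sum.map₂ sym

  between-reverse : ∀ {x y} → ClosedBetween (flip _<_) x y ⊆′ ClosedBetween _<_ x y
  between-reverse z (inj₁ (x≥z , z≥y)) = inj₂ (≤ᵒᵖ⇒≥ z≥y , ≤ᵒᵖ⇒≥ x≥z)
  between-reverse z (inj₂ (y≥z , z≥x)) = inj₁ (≤ᵒᵖ⇒≥ z≥x , ≤ᵒᵖ⇒≥ y≥z)

  reverse-≈* : ∀ {x y} → x W*.≈ y → WellOrderedBy _≤ᵒᵖ_ (ClosedBetween (flip _<_) x y)
  reverse-≈* = wellOrderedBy-map ≤⇒≥ᵒᵖ between-reverse

  reverse-≈ : ∀ {x y} → x W.≈ y → WellOrderedBy (flip _≤ᵒᵖ_) (ClosedBetween (flip _<_) x y)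
  reverse-≈ = wellOrderedBy-map ≤⇒≥ᵒᵖ between-reverse

  interval-reverse : ∀ {S} → IsInterval _<_ S → IsInterval (flip _<_) S
  interval-reverse S-int x y z Sx Sz y<x z<y = S-int z y x Sz Sx z<y y<x

module ChainWithReverse {C : Set} {_<_ : C → C → Set} (sto : IsStrictTotalOrder _≡_ _<_)
            (decide : (P : Set) → Dec P) where

  module ↑ = Chain sto decide
  module ↓ = Chain (Flip.isStrictTotalOrder sto) decide
  open IsStrictTotalOrder sto using (compare; irrefl)

  well*-class-reverse : ∀ {A} → IsWell*Class _<_ A → IsWellClass (flip _<_) A
  well*-class-reverse = isClass-map ↑.reverse-≈* ↓.reverse-≈

  well-class-reverse : ∀ {A} → IsWellClass _<_ A → IsWell*Class (flip _<_) A
  well-class-reverse = isClass-map ↑.reverse-≈ ↓.reverse-≈*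

  enumerations⇒hasOrderTypeℤ : ∀ {S s} → ↑.AscendingEnumeration S s → ↓.AscendingEnumeration S s →
                               HasOrderTypeℤ _<_ S
  enumerations⇒hasOrderTypeℤ {S} {s} up down = f , f-∈ , f-strictMono , f-onto
    where
    module U = ↑.AscendingEnumeration up
    module D = ↓.AscendingEnumeration down
    f : ℤ → C
    f (+ n) = U.seq n
    f -[1+ n ] = D.seq (suc n)
    f-∈ : ∀ i → S (f i)
    f-∈ (+ n) = U.seq-∈ n
    f-∈ -[1+ n ] = D.seq-∈ (suc n)
    f-strictMono : ∀ i j → i ℤ.< j → f i < f j
    f-strictMono _ _ (ℤ.+<+ m<n) = U.seq-strictMono m<n
    f-strictMono _ _ (ℤ.-<- n<m) = D.seq-strictMono (ℕ.s≤s n<m)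
    f-strictMono -[1+ m ] (+ n) ℤ.-<+ =
      ↑.<-≤-trans (subst (D.seq (suc m) <_) D.seq-zero (D.seq-strictMono (ℕ.s≤s ℕ.z≤n))) (U.start-≤ n)
    from-up : ∀ {z} → ∃ (λ n → U.seq n ≡ z) → ∃ λ i → f i ≡ z
    from-up (n , seq≡z) = + n , seq≡z
    from-down : ∀ {z} → z < s → ∃ (λ n → D.seq n ≡ z) → ∃ λ i → f i ≡ z
    from-down z<s (zero , seq0≡z) = ⊥-elim (irrefl (trans (sym seq0≡z) D.seq-zero) z<s)
    from-down z<s (suc n , seq≡z) = -[1+ n ] , seq≡z
    f-onto : ∀ z → S z → ∃ λ i → f i ≡ z
    f-onto z Sz with compare s z
    ... | tri< s<z _ _ = from-up (U.seq-onto Sz (inj₁ s<z))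
    ... | tri≈ _ s≡z _ = from-up (U.seq-onto Sz (inj₂ s≡z))
    ... | tri> _ _ z<s = from-down z<s (D.seq-onto Sz (inj₁ z<s))

  ∩-hasOrderTypeℤ : ∀ {A B u v s} → IsInterval _<_ A → IsInterval _<_ B →
                    IsWellClass _<_ A → IsWell*Class _<_ B →
                    A u → ¬ B u → B v → ¬ A v → v < u → _∩_ _<_ A B s → HasOrderTypeℤ _<_ (_∩_ _<_ A B)
  ∩-hasOrderTypeℤ {A} {B} {u} {v} {s} A-int B-int A-class B-class Au ¬Bu Bv ¬Av v<u Ss =
    enumerations⇒hasOrderTypeℤ (↑S.ascending no-greatest Ss) (↓S.ascending no-least Ss)
    where
    S : Subset C
    S = _∩_ _<_ A B
    module ↑S = ↑.Successor S (↑.∩-interval A-int B-int)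
                  (↑.∩-wellOrdered {B = B} A-class) (↑.∩-reverseWellOrdered {A = A} B-class)
    module ↓S = ↓.Successor S (↑.interval-reverse (↑.∩-interval A-int B-int))
                  (↑.reverse-≈* ∘₂ ↑.∩-reverseWellOrdered {A = A} B-class)
                  (↑.reverse-≈ ∘₂ ↑.∩-wellOrdered {B = B} A-class)
    between : ∀ {z} → S z → v < z × z < u
    between (Az , Bz) = ↑.∩-between B-int A-int Bv ¬Av Au ¬Bu v<u Bz Az
    no-least : ∀ x → S x → ∃ λ z → S z × z < x
    no-least x Sx@(Ax , Bx) = ↑.no-least-in-∩ A-class B-class B-int Bv ¬Av (proj₁ (between Sx)) Ax Bx
    no-greatest : ∀ x → S x → ∃ λ z → S z × x < z
    no-greatest x Sx@(Ax , Bx) with ↓.no-least-in-∩ (well*-class-reverse B-class) (well-class-reverse A-class)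
                                      (↑.interval-reverse A-int) Au ¬Bu (proj₂ (between Sx)) Bx Ax
    ... | z , (Bz , Az) , x<z = z , (Az , Bz) , x<z

  ∩-finite-or-ℤ : ∀ {A B} → IsInterval _<_ A → IsInterval _<_ B →
                  IsWellClass _<_ A → IsWell*Class _<_ B →
                  NonEmpty _<_ (_∩_ _<_ A B) → NonEmpty _<_ (_∖_ _<_ A B) → NonEmpty _<_ (_∖_ _<_ B A) →
                  IsFinite _<_ (_∩_ _<_ A B) ⊎ HasOrderTypeℤ _<_ (_∩_ _<_ A B)
  ∩-finite-or-ℤ A-int B-int A-class B-class (s , Ss) (u , Au , ¬Bu) (v , Bv , ¬Av) with compare u v
  ... | tri< u<v _ _ = inj₁ (↑.∩-isFinite A-int B-int A-class B-class Au ¬Bu Bv ¬Av u<v Ss)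
  ... | tri≈ _ refl _ = ⊥-elim (¬Av Au)
  ... | tri> _ _ v<u = inj₂ (∩-hasOrderTypeℤ A-int B-int A-class B-class Au ¬Bu Bv ¬Av v<u Ss)

module _ {C : Set} {_<_ : C → C → Set} {S S′ : Subset C} (S≐S′ : S ≐′ S′) where

  isFinite-resp-≐ : IsFinite _<_ S → IsFinite _<_ S′
  isFinite-resp-≐ (n , f , f-∈ , f-onto) =
    n , f , (λ i → proj₁ S≐S′ _ (f-∈ i)) , λ z → f-onto z ∘ proj₂ S≐S′ z

  hasOrderTypeℤ-resp-≐ : HasOrderTypeℤ _<_ S → HasOrderTypeℤ _<_ S′
  hasOrderTypeℤ-resp-≐ (f , f-∈ , f-strictMono , f-onto) =
    f , (λ i → proj₁ S≐S′ _ (f-∈ i)) , f-strictMono , λ z → f-onto z ∘ proj₂ S≐S′ z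

lemma5 : ExcludedMiddle (Level.suc 0ℓ) →
    (C : Set) (_<_ : C → C → Set) → IsStrictTotalOrder _≡_ _<_ →
    (A B : Subset C) → IsInterval _<_ A → IsInterval _<_ B →
    ((IsWellClass _<_ A × IsWell*Class _<_ B) ⊎ (IsWell*Class _<_ A × IsWellClass _<_ B)) →
    NonEmpty _<_ (_∩_ _<_ A B) → NonEmpty _<_ (_∖_ _<_ A B) → NonEmpty _<_ (_∖_ _<_ B A) →
    IsFinite _<_ (_∩_ _<_ A B) ⊎ HasOrderTypeℤ _<_ (_∩_ _<_ A B)
lemma5 em C _<_ sto A B A-int B-int (inj₁ (A-class , B-class)) A∩B A∖B B∖A =
  ChainWithReverse.∩-finite-or-ℤ sto (decide em) A-int B-int A-class B-class A∩B A∖B B∖A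
lemma5 em C _<_ sto A B A-int B-int (inj₂ (A-class , B-class)) (s , As , Bs) A∖B B∖A =
  Sum.map (isFinite-resp-≐ {_<_ = _<_} ∩-comm) (hasOrderTypeℤ-resp-≐ {_<_ = _<_} ∩-comm)
    (ChainWithReverse.∩-finite-or-ℤ sto (decide em) B-int A-int B-class A-class (s , Bs , As) B∖A A∖B)
  where
  ∩-comm : _∩_ _<_ B A ≐′ _∩_ _<_ A B
  ∩-comm = (λ _ → Product.swap) , (λ _ → Product.swap)
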